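{- Let $\mathcal V$ be a unital commutative quantale, $F,G\colon\mathsf{Set}\to\mathsf{Set}$ functors, $\zeta\colon F\Rightarrow G$ a natural transformation, and $\hat F,\hat G$ liftings of $F$, $G$ to $\mathcal V\text{ - }\mathsf{Pred}$ with Wasserstein liftings $\bar F,\bar G$ to $\mathcal V\text{ - }\mathsf{Rel}$. If $\zeta$ lifts to a natural transformation $\hat\zeta\colon\hat F\Rightarrow\hat G$, then $\zeta$ lifts to a natural transformation $\bar\zeta\colon\bar F\Rightarrow\bar G$. Furthermore, when $\hat F$ and $\hat G$ are the fibred liftings corresponding to monotone evaluation maps $ev_F\colon F\mathcal V\to \mathcal V$ and $ev_G\colon G\mathcal V\to\mathcal V$ (i.e. $\hat F(p)=ev_F\circ Fp$, $\hat G(p)=ev_G\circ Gp$), then a lifting $\hat\zeta$ of $\zeta$ exists and is unique if and only if $ev_F\le ev_G\circ\zeta_{\mathcal V}$ pointwise.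
   Context: A unital commutative quantale $\mathcal V$ is a complete lattice with an associative, commutative operation $\otimes$ distributing over arbitrary joins, with unit $1$. $\mathcal V\text{ - }\mathsf{Pred}$ has objects $p\colon X\to\mathcal V$ and morphisms $f\colon X\to Y$ from $p$ to $q$ with $p\le q\circ f$; $\mathcal V\text{ - }\mathsf{Rel}$ has objects $r\colon X\times X\to\mathcal V$ and morphisms $f$ from $r$ to $q$ with $r\le q\circ(f\times f)$. A lifting of $F$ to $\mathcal V\text{ - }\mathsf{Pred}$ is a functor sending predicates on $X$ to predicates on $FX$ and morphisms $f$ to $Ff$. The Wasserstein lifting $\bar F$ of $\hat F$ sends $r\colon X\times X\to\mathcal V$ to $\bar F(r)(t_1,t_2)=\bigvee\{\hat F(r)(t)\mid t\in F(X\times X), F\pi_1(t)=t_1, F\pi_2(t)=t_2\}$ (with $r$ viewed as a predicate on $X\times X$) and $f$ to $Ff$. A natural transformation $\zeta\colon F\Rightarrow G$ lifts to $\hat\zeta\colon \hat F\Rightarrow\hat G$ if for every predicate $p$ on $X$, $\zeta_X$ is a morphism $\hat F(p)\to\hat G(p)$, i.e. $\hat F(p)\le\hat G(p)\circ\zeta_X$; similarly it lifts to $\bar\zeta\colon\bar F\Rightarrow\bar G$ if $\bar F(r)\le\bar G(r)\circ(\zeta_X\times\zeta_X)$ for every relation $r$ on $X$. An evaluation map $ev\colon F\mathcal V\to\mathcal V$ is monotone if it is monotone w.r.t. the order $\sqsubseteq$ on $F\mathcal V$ given by $t\sqsubseteq t'$ iff there is $w\in F(R_\le)$ with $F\pi_1(w)=t$,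 $F\pi_2(w)=t'$, where $R_\le\subseteq\mathcal V\times\mathcal V$ is the order relation. -}

module Defs where

open import Level using (0ℓ)
open import Data.Product using (Σ; _×_; _,_; proj₁; proj₂)
open import Relation.Binary.PropositionalEquality using (_≡_)
open import Function using (_∘_; id)

record Quantale : Set₁ where
  infix 4 _≤_
  infixl 7 _⊗_
  field
    Carrier   : Set
    _≤_       : Carrier → Carrier → Set
    ≤-refl    : ∀ {a} → a ≤ a
    ≤-trans   : ∀ {a b c} → a ≤ b → b ≤ c → a ≤ c
    ≤-antisym : ∀ {a b} → a ≤ b → b ≤ a → a ≡ b
    ⋁         : {I : Set} → (I → Carrier) → Carrier
    ⋁-ub      : ∀ {I : Set} (f : I → Carrier) (i : I) → f i ≤ ⋁ f
    ⋁-least   : ∀ {I : Set} (f : I → Carrier) (a : Carrier) →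
                (∀ i → f i ≤ a) → ⋁ f ≤ a
    _⊗_       : Carrier → Carrier → Carrier
    unit      : Carrier
    ⊗-assoc   : ∀ a b c → (a ⊗ b) ⊗ c ≡ a ⊗ (b ⊗ c)
    ⊗-comm    : ∀ a b → a ⊗ b ≡ b ⊗ a
    ⊗-unit    : ∀ a → unit ⊗ a ≡ a
    ⊗-distrib : ∀ {I : Set} (a : Carrier) (f : I → Carrier) →
                a ⊗ ⋁ f ≡ ⋁ (λ i → a ⊗ f i)

record Functor : Set₁ where
  field
    F₀      : Set → Set
    fmap    : {A B : Set} → (A → B) → F₀ A → F₀ B
    fmap-id : {A : Set} (x : F₀ A) → fmap id x ≡ x
    fmap-∘  : {A B C : Set} (g : B → C) (f : A → B) (x : F₀ A) →
              fmap (g ∘ f) x ≡ fmap g (fmap f x)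
open Functor public

record NatTrans (F G : Functor) : Set₁ where
  field
    η       : {X : Set} → F₀ F X → F₀ G X
    natural : {X Y : Set} (f : X → Y) (t : F₀ F X) →
              η (fmap F f t) ≡ fmap G f (η t)
open NatTrans public

module _ (Q : Quantale) where
  open Quantale Q

  PredMap : Functor → Set₁
  PredMap F = {X : Set} → (X → Carrier) → F₀ F X → Carrier

  -- A lifting of F to V-Pred: sends predicates on X to predicates on FX and
  -- every V-Pred morphism f : p → q (p ≤ q ∘ f) to a morphism Ff : F̂p → F̂q.
  -- (Functoriality is automatic: V-Pred → Set is faithful.)
  record Lifting (F : Functor) : Set₁ where
    field
      lift : PredMap F
      lift-mor : {X Y : Set} (f : X → Y) (p : X → Carrier) (q : Y → Carrier) →
                 (∀ x → p x ≤ q (f x)) →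
                 ∀ t → lift p t ≤ lift q (fmap F f t)
  open Lifting public

  wasserstein : (F : Functor) → PredMap F →
                {X : Set} → (X × X → Carrier) → F₀ F X × F₀ F X → Carrier
  wasserstein F Fh {X} r (t₁ , t₂) =
    ⋁ {Σ (F₀ F (X × X)) (λ t → (fmap F proj₁ t ≡ t₁) × (fmap F proj₂ t ≡ t₂))}
      (λ w → Fh r (proj₁ w))

  -- ζ lifts to ζ̂ : F̂ ⇒ Ĝ (each ζ_X is a V-Pred morphism F̂p → Ĝp).
  LiftsPred : (F G : Functor) → NatTrans F G → PredMap F → PredMap G → Set₁
  LiftsPred F G ζ Fh Gh =
    {X : Set} (p : X → Carrier) (t : F₀ F X) → Fh p t ≤ Gh p (η ζ t)

  -- ζ lifts to ζ̄ : F̄ ⇒ Ḡ (each ζ_X is a V-Rel morphism F̄r → Ḡr).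
  LiftsRel : (F G : Functor) → NatTrans F G → PredMap F → PredMap G → Set₁
  LiftsRel F G ζ Fh Gh =
    {X : Set} (r : X × X → Carrier) (t₁ t₂ : F₀ F X) →
    wasserstein F Fh r (t₁ , t₂) ≤ wasserstein G Gh r (η ζ t₁ , η ζ t₂)

  R≤ : Set
  R≤ = Σ (Carrier × Carrier) (λ ab → proj₁ ab ≤ proj₂ ab)

  Below : (F : Functor) → F₀ F Carrier → F₀ F Carrier → Set
  Below F t t' = Σ (F₀ F R≤) (λ w →
      (fmap F (proj₁ ∘ proj₁) w ≡ t) × (fmap F (proj₂ ∘ proj₁) w ≡ t'))

  MonotoneEv : (F : Functor) → (F₀ F Carrier → Carrier) → Set
  MonotoneEv F ev = ∀ (t t' : F₀ F Carrier) → Below F t t' → ev t ≤ ev t'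

  fibred : (F : Functor) → (F₀ F Carrier → Carrier) → PredMap F
  fibred F ev p t = ev (fmap F p t)

-- A coupling w ∈ F(X × X) of t₁ and t₂ is sent by naturality of ζ to a coupling
-- ζ w of ζ t₁ and ζ t₂, and F̂ r w ≤ Ĝ r (ζ w); so every term of the join
-- defining F̄ r (t₁ , t₂) is bounded by a term of the join defining Ḡ r (ζ t₁ , ζ t₂).
-- For fibred liftings, instantiating at the identity predicate on V gives
-- ev_F ≤ ev_G ∘ ζ_V, and conversely ζ_V ∘ Fp = Gp ∘ ζ_X gives the lifting at every p.
-- Uniqueness of ζ̂ is automatic, as lifting ζ is a property of its components.
module Submission where

open import Defs
open import Data.Product using (Σ; _×_; _,_; proj₁; proj₂)
open import Function using (id)
open import Function.Bundles using (_⇔_; mk⇔)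
open import Relation.Binary.PropositionalEquality using (_≡_; sym; trans; cong; subst; subst₂)

module _ (Q : Quantale) where
  open Quantale Q

  Coupling : (F : Functor) {X : Set} → F₀ F X → F₀ F X → Set
  Coupling F {X} t₁ t₂ =
    Σ (F₀ F (X × X)) (λ t → (fmap F proj₁ t ≡ t₁) × (fmap F proj₂ t ≡ t₂))

  η-coupling : {F G : Functor} (ζ : NatTrans F G) {X : Set} {t₁ t₂ : F₀ F X} →
               Coupling F t₁ t₂ → Coupling G (η ζ t₁) (η ζ t₂)
  η-coupling ζ (w , e₁ , e₂) =
    η ζ w , trans (sym (natural ζ proj₁ w)) (cong (η ζ) e₁)
          , trans (sym (natural ζ proj₂ w)) (cong (η ζ) e₂)

  liftsPred⇒liftsRel : (F G : Functor) (ζ : NatTrans F G) (Fh : PredMap Q F) (Gh : PredMap Q G) →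
                       LiftsPred Q F G ζ Fh Gh → LiftsRel Q F G ζ Fh Gh
  liftsPred⇒liftsRel F G ζ Fh Gh ζ̂ r t₁ t₂ = ⋁-least _ _ λ w →
    ≤-trans (ζ̂ r (proj₁ w)) (⋁-ub (λ w′ → Gh r (proj₁ w′)) (η-coupling ζ w))

  module _ {F G : Functor} (ζ : NatTrans F G)
           (evF : F₀ F Carrier → Carrier) (evG : F₀ G Carrier → Carrier) where

    fibred-liftsPred⇒ev≤ev∘η : LiftsPred Q F G ζ (fibred Q F evF) (fibred Q G evG) →
                               ∀ v → evF v ≤ evG (η ζ v)
    fibred-liftsPred⇒ev≤ev∘η ζ̂ v =
      subst₂ (λ s s′ → evF s ≤ evG s′) (fmap-id F v) (fmap-id G (η ζ v)) (ζ̂ id v)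

    ev≤ev∘η⇒fibred-liftsPred : (∀ v → evF v ≤ evG (η ζ v)) →
                               LiftsPred Q F G ζ (fibred Q F evF) (fibred Q G evG)
    ev≤ev∘η⇒fibred-liftsPred ev≤ p t =
      subst (λ s → evF (fmap F p t) ≤ evG s) (natural ζ p t) (ev≤ (fmap F p t))

lemma20 : (Q : Quantale) (F G : Functor) (ζ : NatTrans F G) →
          (Fh : Lifting Q F) (Gh : Lifting Q G) →
          (LiftsPred Q F G ζ (lift Fh) (lift Gh) →
            LiftsRel Q F G ζ (lift Fh) (lift Gh))
          × ((evF : F₀ F (Quantale.Carrier Q) → Quantale.Carrier Q)
             (evG : F₀ G (Quantale.Carrier Q) → Quantale.Carrier Q) →
             MonotoneEv Q F evF → MonotoneEv Q G evG →
             (LiftsPred Q F G ζ (fibred Q F evF) (fibred Q G evG)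
               ⇔ (∀ v → Quantale._≤_ Q (evF v) (evG (η ζ v)))))
lemma20 Q F G ζ Fh Gh =
    liftsPred⇒liftsRel Q F G ζ (lift Fh) (lift Gh)
  , λ evF evG _ _ → mk⇔ (fibred-liftsPred⇒ev≤ev∘η Q ζ evF evG)
                        (ev≤ev∘η⇒fibred-liftsPred Q ζ evF evG)
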